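{- Let $n$ be a positive integer. Then $\varphi_8(n)$ is odd if and only if $n=8$, $n=16$, or $n$ is of one of the following forms, where $p,p_1,p_2$ denote odd primes with $p_1\ne p_2$ and $\alpha,\alpha_1,\alpha_2$ denote positive integers: (1) $n=p^{\alpha}$ with $p\equiv 9$ or $15\pmod{16}$; or $p\equiv 3$ or $5\pmod{16}$ and $\alpha$ even; or $p\equiv 11$ or $13\pmod{16}$ and $\alpha$ odd; (2) $n=2p^{\alpha}$ with $p\equiv 7$ or $9\pmod{16}$; or $p\equiv 3$ or $13\pmod{16}$ and $\alpha$ even; or $p\equiv 5$ or $11\pmod{16}$ and $\alpha$ odd; (3) $n=4p^{\alpha}$ with $p\equiv 3$ or $5\pmod 8$; (4) $n=8p^{\alpha}$ with $p\equiv 3$ or $7\pmod 8$; (5) $n=p_1^{\alpha_1}p_2^{\alpha_2}$ with $p_1\equiv p_2\equiv 3\pmod 8$, or $p_1\equiv p_2\equiv5\pmod 8$, or $p_1\equiv 3\pmod 8$ and $p_2\equiv 5\pmod 8$; (6) $n=2p_1^{\alpha_1}p_2^{\alpha_2}$ with $p_1\equiv p_2\equiv 3\pmod 8$, or $p_1\equiv p_2\equiv5\pmod 8$, or $p_1\equiv 3\pmod 8$ and $p_2\equiv 5\pmod 8$.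
   Context: For positive integers $n,e$, the generalized Euler function is $\varphi_e(n)=\#\{i\in\mathbb{Z}: 1\le i\le \lfloor n/e\rfloor,\ \gcd(i,n)=1\}$, where $\lfloor x\rfloor$ is the greatest integer not exceeding $x$. -}

module Defs where

open import Data.Nat using (ℕ; suc; _+_; _*_; _^_; _≤_; _%_; _/_; NonZero)
open import Data.Nat.Coprimality using (Coprime; coprime?)
open import Data.Nat.Primality using (Prime)
open import Data.List using (List; length; filter; applyUpTo)
open import Data.Product using (_×_; ∃-syntax)
open import Data.Sum using (_⊎_)
open import Relation.Binary.PropositionalEquality using (_≡_; _≢_)

oneTo : ℕ → List ℕ
oneTo m = applyUpTo suc m

φ : (e : ℕ) → .{{NonZero e}} → ℕ → ℕ
φ e n = length (filter (λ i → coprime? i n) (oneTo (n / e)))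

IsOdd : ℕ → Set
IsOdd m = m % 2 ≡ 1

IsEven : ℕ → Set
IsEven m = m % 2 ≡ 0

OddPrime : ℕ → Set
OddPrime p = Prime p × IsOdd p

cond1 : ℕ → ℕ → Set
cond1 p α = (p % 16 ≡ 9 ⊎ p % 16 ≡ 15)
          ⊎ ((p % 16 ≡ 3 ⊎ p % 16 ≡ 5) × IsEven α)
          ⊎ ((p % 16 ≡ 11 ⊎ p % 16 ≡ 13) × IsOdd α)

cond2 : ℕ → ℕ → Set
cond2 p α = (p % 16 ≡ 7 ⊎ p % 16 ≡ 9)
          ⊎ ((p % 16 ≡ 3 ⊎ p % 16 ≡ 13) × IsEven α)
          ⊎ ((p % 16 ≡ 5 ⊎ p % 16 ≡ 11) × IsOdd α)

cond3 : ℕ → Set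
cond3 p = p % 8 ≡ 3 ⊎ p % 8 ≡ 5

cond4 : ℕ → Set
cond4 p = p % 8 ≡ 3 ⊎ p % 8 ≡ 7

condPair : ℕ → ℕ → Set
condPair p₁ p₂ = (p₁ % 8 ≡ 3 × p₂ % 8 ≡ 3)
               ⊎ (p₁ % 8 ≡ 5 × p₂ % 8 ≡ 5)
               ⊎ (p₁ % 8 ≡ 3 × p₂ % 8 ≡ 5)

Form1 Form2 Form3 Form4 Form5 Form6 : ℕ → Set
Form1 n = ∃[ p ] ∃[ α ] (OddPrime p × 1 ≤ α × n ≡ p ^ α × cond1 p α)
Form2 n = ∃[ p ] ∃[ α ] (OddPrime p × 1 ≤ α × n ≡ 2 * p ^ α × cond2 p α)
Form3 n = ∃[ p ] ∃[ α ] (OddPrime p × 1 ≤ α × n ≡ 4 * p ^ α × cond3 p)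
Form4 n = ∃[ p ] ∃[ α ] (OddPrime p × 1 ≤ α × n ≡ 8 * p ^ α × cond4 p)
Form5 n = ∃[ p₁ ] ∃[ p₂ ] ∃[ α₁ ] ∃[ α₂ ]
  (OddPrime p₁ × OddPrime p₂ × p₁ ≢ p₂ × 1 ≤ α₁ × 1 ≤ α₂
   × n ≡ p₁ ^ α₁ * p₂ ^ α₂ × condPair p₁ p₂)
Form6 n = ∃[ p₁ ] ∃[ p₂ ] ∃[ α₁ ] ∃[ α₂ ]
  (OddPrime p₁ × OddPrime p₂ × p₁ ≢ p₂ × 1 ≤ α₁ × 1 ≤ α₂
   × n ≡ 2 * (p₁ ^ α₁ * p₂ ^ α₂) × condPair p₁ p₂)

Exceptional : ℕ → Set
Exceptional n = n ≡ 8 ⊎ n ≡ 16 ⊎ Form1 n ⊎ Form2 n ⊎ Form3 n ⊎ Form4 n ⊎ Form5 n ⊎ Form6 n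

{-# OPTIONS --safe #-}
module Submission where

-- Write C(m, x) for the number of 1 ≤ i ≤ x coprime to m, so that φ₈(n) = C(n, ⌊n/8⌋). A prime already
-- dividing m does not change C(m, x) when m is multiplied by it, while for a prime p ∤ m inclusion–exclusion
-- gives C(pm, x) = C(m, x) − C(m, ⌊x/p⌋). Hence for odd m and multiples N of m the parity of C(m, ⌊N/8⌋) is a
-- function of N mod 16: the parity of ⌊N/8⌋ for m = 1, and each odd prime p ∣ m twists a law t into
-- c ↦ t(c) + t(c/p). Three twists of the law of 1 vanish identically, so only
-- m = 1, p^α and p₁^α₁ p₂^α₂ can give an odd value; for n = 2^k m the same recursion with p = 2 forces k ≤ 4.
-- The remaining cases depend only on p mod 16 and α mod 4 (as p⁴ ≡ 1 mod 16) and are settled by evaluation.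

open import Defs
open import Data.Bool using (Bool; true; false; _∧_; _∨_; T; if_then_else_)
open import Data.Bool.Properties using (T-∨; T-∧)
open import Data.Empty using (⊥-elim)
open import Data.List using ([]; _∷_; length; filter; _++_)
open import Data.List.Properties using (applyUpTo-∷ʳ; length-applyUpTo; filter-++; filter-all; length-++; filter-≐)
open import Data.List.Relation.Unary.All using (universal; _∷_)
open import Data.Nat
open import Data.Nat.Coprimality using (Coprime; coprime?; coprime-divisor) renaming (sym to coprime-sym)
open import Data.Nat.Divisibility
open import Data.Nat.DivMod
open import Data.Nat.Induction using (<-rec)
open import Data.Nat.ListAction using (product)
open import Data.Nat.Primality
  using (Prime; prime[2]; ¬prime[1]; euclidsLemma; prime⇒irreducible; prime⇒nonZero; prime⇒nonTrivial)
open import Data.Nat.Primality.Factorisation using (factorise)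
open import Data.Nat.Properties
open import Data.Nat.Solver using (module +-*-Solver)
open +-*-Solver using (solve; _:*_; _:=_)
open import Data.Parity.Base using (Parity; 0ℙ; 1ℙ) renaming (_+_ to _⊕_)
import Data.Parity.Properties as ℙ
open import Data.Product using (_×_; _,_; ∃-syntax; Σ-syntax)
open import Data.Product.Function.NonDependent.Propositional using (_×-⇔_)
open import Data.Sum using (_⊎_; inj₁; inj₂)
open import Data.Sum.Function.Propositional using (_⊎-⇔_)
open import Function using (_∘_)
open import Function.Bundles using (_⇔_; mk⇔; Equivalence)
open import Function.Properties.Equivalence using () renaming (trans to ⇔-trans)
open import Level using (0ℓ)
open import Relation.Binary.Bundles using (Setoid)
open import Relation.Binary.PropositionalEquality
import Relation.Binary.Reasoning.Setoid as SetoidReasoning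
open import Relation.Nullary using (¬_; Dec; yes; no; does)
open import Relation.Nullary.Decidable using (dec-false; map; _→-dec_; from-yes)
open import Relation.Unary using (Decidable)

open import Algebra.Properties.CommutativeSemigroup +-commutativeSemigroup using (xy∙z≈xz∙y)

parity-*2 : ∀ m → parity (m * 2) ≡ 0ℙ
parity-*2 m = trans (ℙ.*-homo-* m 2) (ℙ.*-zeroʳ (parity m))

parity-%2 : ∀ m → parity (m % 2) ≡ parity m
parity-%2 m = begin
  parity (m % 2)                       ≡⟨ ℙ.+-identityʳ (parity (m % 2)) ⟨
  parity (m % 2) ⊕ 0ℙ                  ≡⟨ cong (parity (m % 2) ⊕_) (parity-*2 (m / 2)) ⟨
  parity (m % 2) ⊕ parity (m / 2 * 2)  ≡⟨ ℙ.+-homo-+ (m % 2) (m / 2 * 2) ⟨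
  parity (m % 2 + m / 2 * 2)           ≡⟨ cong parity (m≡m%n+[m/n]*n m 2) ⟨
  parity m                             ∎
  where open ≡-Reasoning

odd⇒parity≡1ℙ : ∀ {m} → IsOdd m → parity m ≡ 1ℙ
odd⇒parity≡1ℙ {m} m%2≡1 = trans (sym (parity-%2 m)) (cong parity m%2≡1)

parity≡1ℙ⇒odd : ∀ {m} → parity m ≡ 1ℙ → IsOdd m
parity≡1ℙ⇒odd {m} eq with m % 2 | m%n<n m 2 | parity-%2 m
... | 0 | _ | e = ⊥-elim (ℙ.p≢p⁻¹ 0ℙ (trans e eq))
... | 1 | _ | _ = refl
... | suc (suc _) | s≤s (s≤s ()) | _

odd⇒2∤ : ∀ {m} → IsOdd m → ¬ 2 ∣ m
odd⇒2∤ {m} m%2≡1 2∣m with trans (sym m%2≡1) (n∣m⇒m%n≡0 m 2 2∣m)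
... | ()

2∤⇒odd : ∀ {m} → ¬ 2 ∣ m → IsOdd m
2∤⇒odd {m} 2∤m with m % 2 | m%n<n m 2 | m≡m%n+[m/n]*n m 2
... | 1 | _ | _ = refl
... | 0 | _ | m≡m/2*2 = ⊥-elim (2∤m (divides (m / 2) m≡m/2*2))
... | suc (suc _) | s≤s (s≤s ()) | _

odd-∣ : ∀ {d m} → d ∣ m → IsOdd m → IsOdd d
odd-∣ d∣m m-odd = 2∤⇒odd λ 2∣d → odd⇒2∤ m-odd (∣-trans 2∣d d∣m)

odd-* : ∀ x y → IsOdd x → IsOdd y → IsOdd (x * y)
odd-* x y x-odd y-odd = trans (%-distribˡ-* x y 2) (cong₂ (λ a b → a * b % 2) x-odd y-odd)

odd-^ : ∀ p → IsOdd p → ∀ a → IsOdd (p ^ a)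
odd-^ p p-odd zero = refl
odd-^ p p-odd (suc a) = odd-* p (p ^ a) p-odd (odd-^ p p-odd a)

odd⇒%16-odd : ∀ p → IsOdd p → IsOdd (p % 16)
odd⇒%16-odd p p-odd = trans (m∣n⇒o%n%m≡o%m 2 16 p (divides 8 refl)) p-odd

prime∤1 : ∀ {p} → Prime p → ¬ p ∣ 1
prime∤1 p-prime p∣1 = ¬prime[1] (subst Prime (∣1⇒≡1 p∣1) p-prime)

prime≥2 : ∀ {p} → Prime p → 2 ≤ p
prime≥2 {p} p-prime = nonTrivial⇒n>1 p {{prime⇒nonTrivial p-prime}}

prime∣^⇒≡ : ∀ {p q} → Prime p → Prime q → ∀ b → p ∣ q ^ b → p ≡ q
prime∣^⇒≡ p-prime q-prime zero p∣1 = ⊥-elim (prime∤1 p-prime p∣1)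
prime∣^⇒≡ {p} {q} p-prime q-prime (suc b) p∣q^[1+b] with euclidsLemma q (q ^ b) p-prime p∣q^[1+b]
... | inj₂ p∣q^b = prime∣^⇒≡ p-prime q-prime b p∣q^b
... | inj₁ p∣q with prime⇒irreducible q-prime p∣q
...   | inj₂ p≡q = p≡q
...   | inj₁ refl = ⊥-elim (¬prime[1] p-prime)

prime-divisor : ∀ m → .{{NonZero m}} → m ≢ 1 → ∃[ p ] (Prime p × p ∣ m)
prime-divisor m m≢1 with factorise m
... | record { factors = [] ; isFactorisation = m≡1 } = ⊥-elim (m≢1 m≡1)
... | record { factors = p ∷ ps ; isFactorisation = m≡p*ps ; factorsPrime = p-prime ∷ _ } =
  p , p-prime , divides (product ps) (trans m≡p*ps (*-comm p (product ps)))

FactorsOut : ℕ → ℕ → Set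
FactorsOut d m = ∃[ a ] ∃[ u ] (m ≡ d ^ a * u × ¬ d ∣ u)

factorOut : ∀ {d} → 2 ≤ d → ∀ m → .{{NonZero m}} → FactorsOut d m
factorOut {d} 2≤d m = <-rec (λ m → .{{NonZero m}} → FactorsOut d m) step m
  where
  step : ∀ m → (∀ {k} → k < m → .{{NonZero k}} → FactorsOut d k) → .{{NonZero m}} → FactorsOut d m
  step m smaller with d ∣? m
  ... | no d∤m = 0 , m , sym (*-identityˡ m) , d∤m
  ... | yes (divides zero m≡0) = ⊥-elim (≢-nonZero⁻¹ m m≡0)
  ... | yes (divides q@(suc _) m≡q*d) with smaller (subst (q <_) (sym m≡q*d) (m<m*n q d 2≤d))
  ... | a , u , q≡d^a*u , d∤u = suc a , u , trans m≡q*d (trans (cong (_* d) q≡d^a*u) (regroup (d ^ a) u)) , d∤u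
    where
    regroup : ∀ x y → x * y * d ≡ d * x * y
    regroup x y = solve 3 (λ x y d → x :* y :* d := d :* x :* y) refl x y d

coprime-∣ʳ : ∀ {a b d} → Coprime a b → d ∣ b → Coprime a d
coprime-∣ʳ c d∣b (e∣a , e∣d) = c (e∣a , ∣-trans e∣d d∣b)

coprime-*ʳ : ∀ {a b c} → Coprime a b → Coprime a c → Coprime a (b * c)
coprime-*ʳ cab cac (d∣a , d∣bc) =
  cac (d∣a , coprime-divisor (coprime-sym (coprime-∣ʳ (coprime-sym cab) d∣a)) d∣bc)

∤⇒coprime : ∀ {p y} → Prime p → ¬ p ∣ y → Coprime y p
∤⇒coprime p-prime p∤y (d∣y , d∣p) with prime⇒irreducible p-prime d∣p
... | inj₁ d≡1 = d≡1
... | inj₂ refl = ⊥-elim (p∤y d∣y)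

[1+m]/n≡m/n : ∀ m n .{{_ : NonZero n}} → ¬ n ∣ suc m → suc m / n ≡ m / n
[1+m]/n≡m/n m n n∤1+m with m<1+n⇒m<n∨m≡n (s≤s (m%n<n m n))
... | inj₁ 1+m%n<n = trans (cong (_/ n) (cong suc (m≡m%n+[m/n]*n m n))) (quotient-unique 1+m%n<n)
  where
  quotient-unique : ∀ {r} → r < n → (r + m / n * n) / n ≡ m / n
  quotient-unique r<n = trans (+-distrib-/-∣ʳ _ (divides-refl (m / n)))
                              (cong₂ _+_ (m<n⇒m/n≡0 r<n) (m*n/n≡m (m / n) n))
... | inj₂ 1+m%n≡n = ⊥-elim (n∤1+m (divides (suc (m / n))
  (trans (cong suc (m≡m%n+[m/n]*n m n)) (cong (_+ m / n * n) 1+m%n≡n))))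

[1+m]/n≡1+m/n : ∀ m n .{{_ : NonZero n}} → n ∣ suc m → suc m / n ≡ suc (m / n)
[1+m]/n≡1+m/n m n (divides zero ())
[1+m]/n≡1+m/n m n@(suc n-1) (divides (suc k) 1+m≡[1+k]*n) =
  trans (cong (_/ n) 1+m≡[1+k]*n) (trans (m*n/n≡m (suc k) n) (cong suc (sym m/n≡k)))
  where
  m/n≡k : m / n ≡ k
  m/n≡k = trans (cong (_/ n) (suc-injective 1+m≡[1+k]*n))
                (trans (+-distrib-/-∣ʳ n-1 (divides-refl k)) (cong₂ _+_ (m<n⇒m/n≡0 ≤-refl) (m*n/n≡m k n)))

m/n/o≡m/o/n : ∀ m n o .{{_ : NonZero n}} .{{_ : NonZero o}} → m / n / o ≡ m / o / n
m/n/o≡m/o/n m n o = begin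
    m / n / o        ≡⟨ m/n/o≡m/[n*o] m n o ⟩
    m / (n * o)      ≡⟨ /-congʳ (*-comm n o) ⟩
    m / (o * n)      ≡⟨ m/n/o≡m/[n*o] m o n ⟨
    m / o / n        ∎
  where
  open ≡-Reasoning
  instance
    n*o≢0 : NonZero (n * o)
    n*o≢0 = m*n≢0 n o
    o*n≢0 : NonZero (o * n)
    o*n≢0 = m*n≢0 o n

-- Counting integers coprime to m

does-⇔ : ∀ {A B : Set} (a? : Dec A) (b? : Dec B) → (A → B) → (B → A) → does a? ≡ does b?
does-⇔ (yes a) (yes b) f g = refl
does-⇔ (yes a) (no ¬b) f g = ⊥-elim (¬b (f a))
does-⇔ (no ¬a) (yes b) f g = ⊥-elim (¬a (g b))
does-⇔ (no ¬a) (no ¬b) f g = refl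

coprimeᵇ : ℕ → ℕ → Bool
coprimeᵇ i m = does (coprime? i m)

indicator : Bool → ℕ
indicator b = if b then 1 else 0

length-filter-[x] : ∀ {P : ℕ → Set} (P? : Decidable P) x →
  length (filter P? (x ∷ [])) ≡ indicator (does (P? x))
length-filter-[x] P? x with P? x
... | yes _ = refl
... | no _ = refl

coprimeCount : ℕ → ℕ → ℕ
coprimeCount m x = length (filter (λ i → coprime? i m) (oneTo x))

coprimeCount-suc : ∀ m x →
  coprimeCount m (suc x) ≡ coprimeCount m x + indicator (coprimeᵇ (suc x) m)
coprimeCount-suc m x = begin
    coprimeCount m (suc x)                                  ≡⟨ cong (length ∘ filter P?) (applyUpTo-∷ʳ suc x) ⟨
    length (filter P? (oneTo x ++ suc x ∷ []))              ≡⟨ cong length (filter-++ P? (oneTo x) (suc x ∷ [])) ⟩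
    length (filter P? (oneTo x) ++ filter P? (suc x ∷ []))  ≡⟨ length-++ (filter P? (oneTo x)) ⟩
    coprimeCount m x + length (filter P? (suc x ∷ []))      ≡⟨ cong (coprimeCount m x +_) last ⟩
    coprimeCount m x + indicator (coprimeᵇ (suc x) m)       ∎
  where
  open ≡-Reasoning
  P? = λ i → coprime? i m
  last : length (filter P? (suc x ∷ [])) ≡ indicator (coprimeᵇ (suc x) m)
  last = length-filter-[x] P? (suc x)

coprimeCount-1 : ∀ x → coprimeCount 1 x ≡ x
coprimeCount-1 x = begin
    length (filter (λ i → coprime? i 1) (oneTo x))
      ≡⟨ cong length (filter-all (λ i → coprime? i 1) (universal coprime-1 (oneTo x))) ⟩
    length (oneTo x)  ≡⟨ length-applyUpTo suc x ⟩
    x                 ∎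
  where
  open ≡-Reasoning
  coprime-1 : ∀ i → Coprime i 1
  coprime-1 i (_ , d∣1) = ∣1⇒≡1 d∣1

coprimeCount-∣* : ∀ d {m} → d ∣ m → ∀ x → coprimeCount (d * m) x ≡ coprimeCount m x
coprimeCount-∣* d {m} d∣m x =
  cong length (filter-≐ (λ i → coprime? i (d * m)) (λ i → coprime? i m) (to , from) (oneTo x))
  where
  to : ∀ {i} → Coprime i (d * m) → Coprime i m
  to c = coprime-∣ʳ c (n∣m*n d)
  from : ∀ {i} → Coprime i m → Coprime i (d * m)
  from c = coprime-*ʳ (coprime-∣ʳ c d∣m) c

coprimeCount-^* : ∀ d m a x → coprimeCount (d ^ suc a * m) x ≡ coprimeCount (d * m) x
coprimeCount-^* d m zero x = cong (λ z → coprimeCount (z * m) x) (*-identityʳ d)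
coprimeCount-^* d m (suc a) x = begin
    coprimeCount (d * d ^ suc a * m) x   ≡⟨ cong (λ z → coprimeCount z x) (*-assoc d (d ^ suc a) m) ⟩
    coprimeCount (d * (d ^ suc a * m)) x ≡⟨ coprimeCount-∣* d (∣-trans (m∣m*n (d ^ a)) (m∣m*n m)) x ⟩
    coprimeCount (d ^ suc a * m) x       ≡⟨ coprimeCount-^* d m a x ⟩
    coprimeCount (d * m) x               ∎
  where open ≡-Reasoning

module _ {p m : ℕ} (p-prime : Prime p) (p∤m : ¬ p ∣ m) where
  private instance
    p≢0 : NonZero p
    p≢0 = prime⇒nonZero p-prime

  coprimeCount-prime* : ∀ x → coprimeCount (p * m) x + coprimeCount m (x / p) ≡ coprimeCount m x
  coprimeCount-prime* zero rewrite 0/n≡0 p {{p≢0}} = refl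
  coprimeCount-prime* (suc x) with p ∣? suc x
  ... | no p∤1+x = begin
      coprimeCount (p * m) (suc x) + coprimeCount m (suc x / p)
        ≡⟨ cong₂ _+_ (coprimeCount-suc (p * m) x) (cong (coprimeCount m) ([1+m]/n≡m/n x p p∤1+x)) ⟩
      A + indicator (coprimeᵇ (suc x) (p * m)) + B ≡⟨ xy∙z≈xz∙y A _ B ⟩
      A + B + indicator (coprimeᵇ (suc x) (p * m)) ≡⟨ cong₂ _+_ (coprimeCount-prime* x) (cong indicator same) ⟩
      coprimeCount m x + indicator (coprimeᵇ (suc x) m) ≡⟨ coprimeCount-suc m x ⟨
      coprimeCount m (suc x) ∎
    where
    open ≡-Reasoning
    A = coprimeCount (p * m) x
    B = coprimeCount m (x / p)
    same : coprimeᵇ (suc x) (p * m) ≡ coprimeᵇ (suc x) m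
    same = does-⇔ (coprime? (suc x) (p * m)) (coprime? (suc x) m)
      (λ c → coprime-∣ʳ c (n∣m*n p)) (coprime-*ʳ (∤⇒coprime p-prime p∤1+x))
  ... | yes p∣1+x = begin
      coprimeCount (p * m) (suc x) + coprimeCount m (suc x / p)
        ≡⟨ cong₂ _+_ (coprimeCount-suc (p * m) x) (cong (coprimeCount m) ([1+m]/n≡1+m/n x p p∣1+x)) ⟩
      A + indicator (coprimeᵇ (suc x) (p * m)) + coprimeCount m q
        ≡⟨ cong₂ (λ b c → A + indicator b + c) dropped (coprimeCount-suc m (x / p)) ⟩
      A + 0 + (B + indicator (coprimeᵇ q m)) ≡⟨ cong (_+ (B + indicator (coprimeᵇ q m))) (+-identityʳ A) ⟩
      A + (B + indicator (coprimeᵇ q m)) ≡⟨ +-assoc A B _ ⟨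
      A + B + indicator (coprimeᵇ q m) ≡⟨ cong₂ _+_ (coprimeCount-prime* x) (cong indicator moved) ⟩
      coprimeCount m x + indicator (coprimeᵇ (suc x) m) ≡⟨ coprimeCount-suc m x ⟨
      coprimeCount m (suc x) ∎
    where
    open ≡-Reasoning
    A = coprimeCount (p * m) x
    B = coprimeCount m (x / p)
    q = suc (x / p)
    1+x≡q*p : suc x ≡ q * p
    1+x≡q*p = trans (sym (m/n*n≡m p∣1+x)) (cong (_* p) ([1+m]/n≡1+m/n x p p∣1+x))
    dropped : coprimeᵇ (suc x) (p * m) ≡ false
    dropped = dec-false (coprime? _ _) λ c → ¬prime[1] (subst Prime (c (p∣1+x , m∣m*n m)) p-prime)
    moved : coprimeᵇ q m ≡ coprimeᵇ (suc x) m
    moved = does-⇔ (coprime? q m) (coprime? (suc x) m)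
      (λ c → subst (λ y → Coprime y m) (sym 1+x≡q*p)
               (coprime-sym (coprime-*ʳ (coprime-sym c) (∤⇒coprime p-prime p∤m))))
      (λ c → coprime-sym (coprime-∣ʳ (coprime-sym c) (subst (q ∣_) (sym 1+x≡q*p) (m∣m*n p))))

  parity-coprimeCount-prime* : ∀ x →
    parity (coprimeCount (p * m) x) ≡ parity (coprimeCount m x) ⊕ parity (coprimeCount m (x / p))
  parity-coprimeCount-prime* x = begin
      parity A                         ≡⟨ ℙ.+-identityʳ (parity A) ⟨
      parity A ⊕ 0ℙ                    ≡⟨ cong (parity A ⊕_) (ℙ.p+p≡0ℙ (parity B)) ⟨
      parity A ⊕ (parity B ⊕ parity B) ≡⟨ ℙ.+-assoc (parity A) (parity B) (parity B) ⟨
      parity A ⊕ parity B ⊕ parity B   ≡⟨ cong (_⊕ parity B) (ℙ.+-homo-+ A B) ⟨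
      parity (A + B) ⊕ parity B        ≡⟨ cong (λ y → parity y ⊕ parity B) (coprimeCount-prime* x) ⟩
      parity (coprimeCount m x) ⊕ parity B ∎
    where
    open ≡-Reasoning
    A = coprimeCount (p * m) x
    B = coprimeCount m (x / p)

Below : ℕ → (ℕ → Set) → Set
Below n P = ∀ {r} → r < n → P r

below? : ∀ {P : ℕ → Set} → Decidable P → ∀ n → Dec (Below n P)
below? P? zero = yes λ ()
below? {P} P? (suc n) with below? P? n | P? n
... | yes below | yes at-n = yes extend
  where
  extend : Below (suc n) P
  extend r<1+n with m<1+n⇒m<n∨m≡n r<1+n
  ... | inj₁ r<n = below r<n
  ... | inj₂ refl = at-n
... | no ¬below | _ = no λ below → ¬below (λ r<n → below (m<n⇒m<1+n r<n))
... | _ | no ¬at-n = no λ below → ¬at-n (below ≤-refl)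

OddResidues : (ℕ → Set) → Set
OddResidues P = ∀ p → IsOdd p → P (p % 16)

oddResidues? : ∀ {P : ℕ → Set} → Decidable P → Dec (OddResidues P)
oddResidues? {P} P? = map (mk⇔ to from) (below? (λ r → (r % 2 ≟ 1) →-dec P? r) 16)
  where
  to : Below 16 (λ r → IsOdd r → P r) → OddResidues P
  to below p p-odd = below (m%n<n p 16) (odd⇒%16-odd p p-odd)
  from : OddResidues P → Below 16 (λ r → IsOdd r → P r)
  from all {r} r<16 r-odd = subst P (m<n⇒m%n≡m r<16) (all r r-odd)

-- Arithmetic modulo 16

module ModularArithmetic (n : ℕ) .{{_ : NonZero n}} where

  infix 4 _≋_
  record _≋_ (a b : ℕ) : Set where
    constructor mk≋
    field ≋⇒%≡ : a % n ≡ b % n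
  open _≋_ public

  ≡⇒≋ : ∀ {a b} → a ≡ b → a ≋ b
  ≡⇒≋ refl = mk≋ refl

  ≋-refl : ∀ a → a ≋ a
  ≋-refl a = mk≋ refl

  ≋-sym : ∀ {a b} → a ≋ b → b ≋ a
  ≋-sym (mk≋ e) = mk≋ (sym e)

  ≋-trans : ∀ {a b c} → a ≋ b → b ≋ c → a ≋ c
  ≋-trans (mk≋ e) (mk≋ f) = mk≋ (trans e f)

  %-≋ : ∀ a → a % n ≋ a
  %-≋ a = mk≋ (m%n%n≡m%n a n)

  *-cong-≋ : ∀ {a b c d} → a ≋ b → c ≋ d → a * c ≋ b * d
  *-cong-≋ {a} {b} {c} {d} (mk≋ a≋b) (mk≋ c≋d) = mk≋ (begin
      a * c % n               ≡⟨ %-distribˡ-* a c n ⟩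
      (a % n) * (c % n) % n   ≡⟨ cong₂ (λ x y → x * y % n) a≋b c≋d ⟩
      (b % n) * (d % n) % n   ≡⟨ %-distribˡ-* b d n ⟨
      b * d % n               ∎)
    where open ≡-Reasoning

  ^-cong-≋ : ∀ {a b} → a ≋ b → ∀ k → a ^ k ≋ b ^ k
  ^-cong-≋ a≋b zero = ≋-refl 1
  ^-cong-≋ a≋b (suc k) = *-cong-≋ a≋b (^-cong-≋ a≋b k)

  ≋-setoid : Setoid 0ℓ 0ℓ
  ≋-setoid = record
    { Carrier = ℕ
    ; _≈_ = _≋_
    ; isEquivalence = record { refl = ≋-refl _ ; sym = ≋-sym ; trans = ≋-trans }
    }

  module ≋-Reasoning = SetoidReasoning ≋-setoid

open ModularArithmetic 16

fourthPowers≡1 : OddResidues (λ r → r ^ 4 % 16 ≡ 1)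
fourthPowers≡1 = from-yes (oddResidues? (λ r → r ^ 4 % 16 ≟ 1))

odd⇒^4≋1 : ∀ p → IsOdd p → p ^ 4 ≋ 1
odd⇒^4≋1 p p-odd = ≋-trans (^-cong-≋ (≋-sym (%-≋ p)) 4) (mk≋ (fourthPowers≡1 p p-odd))

odd⇒^≋^%4 : ∀ p → IsOdd p → ∀ a → p ^ a ≋ (p % 16) ^ (a % 4)
odd⇒^≋^%4 p p-odd a = begin
    p ^ a                            ≈⟨ ^-cong-≋ (%-≋ p) a ⟨
    r ^ a                            ≡⟨ cong (r ^_) (m≡m%n+[m/n]*n a 4) ⟩
    r ^ (a % 4 + a / 4 * 4)          ≡⟨ ^-distribˡ-+-* r (a % 4) (a / 4 * 4) ⟩
    r ^ (a % 4) * r ^ (a / 4 * 4)    ≡⟨ cong (λ e → r ^ (a % 4) * r ^ e) (*-comm (a / 4) 4) ⟩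
    r ^ (a % 4) * r ^ (4 * (a / 4))  ≡⟨ cong (r ^ (a % 4) *_) (^-*-assoc r 4 (a / 4)) ⟨
    r ^ (a % 4) * (r ^ 4) ^ (a / 4)
      ≈⟨ *-cong-≋ (≋-refl (r ^ (a % 4))) (^-cong-≋ (odd⇒^4≋1 r (odd⇒%16-odd p p-odd)) (a / 4)) ⟩
    r ^ (a % 4) * 1 ^ (a / 4)        ≡⟨ cong (r ^ (a % 4) *_) (^-zeroˡ (a / 4)) ⟩
    r ^ (a % 4) * 1                  ≡⟨ *-identityʳ (r ^ (a % 4)) ⟩
    r ^ (a % 4)                      ∎
  where
  open ≋-Reasoning
  r = p % 16

/-≋-*^3 : ∀ {p N} .{{_ : NonZero p}} → IsOdd p → p ∣ N → N / p ≋ N % 16 * (p % 16) ^ 3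
/-≋-*^3 {p} {N} p-odd p∣N = begin
    N / p                  ≡⟨ *-identityʳ (N / p) ⟨
    N / p * 1              ≈⟨ *-cong-≋ (≋-refl (N / p)) (odd⇒^4≋1 p p-odd) ⟨
    N / p * p ^ 4          ≡⟨ *-assoc (N / p) p (p ^ 3) ⟨
    N / p * p * p ^ 3      ≡⟨ cong (_* p ^ 3) (m/n*n≡m p∣N) ⟩
    N * p ^ 3              ≈⟨ *-cong-≋ (%-≋ N) (^-cong-≋ (%-≋ p) 3) ⟨
    N % 16 * (p % 16) ^ 3  ∎
  where open ≋-Reasoning

%4%2≡%2 : ∀ a → a % 4 % 2 ≡ a % 2
%4%2≡%2 a = m∣n⇒o%n%m≡o%m 2 4 a (divides 2 refl)

%16%8≡%8 : ∀ p → p % 16 % 8 ≡ p % 8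
%16%8≡%8 p = m∣n⇒o%n%m≡o%m 8 16 p (divides 2 refl)

-- Parity laws

record ParityLaw (m : ℕ) (t : ℕ → Parity) : Set where
  field at : ∀ N → m ∣ N → parity (coprimeCount m (N / 8)) ≡ t (N % 16)
open ParityLaw

baseLaw : ℕ → Parity
baseLaw c = parity (c / 8)

parityLaw-1 : ParityLaw 1 baseLaw
parityLaw-1 .at N _ = begin
    parity (coprimeCount 1 (N / 8)) ≡⟨ cong parity (coprimeCount-1 (N / 8)) ⟩
    parity (N / 8)                  ≡⟨ parity-%2 (N / 8) ⟨
    parity (N / 8 % 2)              ≡⟨ cong parity (m%[n*o]/o≡m/o%n N 2 8) ⟨
    parity (N % 16 / 8)             ∎
  where open ≡-Reasoning

-- For odd r, c · r³ ≡ c / r (mod 16) since r⁴ ≡ 1 (mod 16).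
twist : ℕ → (ℕ → Parity) → ℕ → Parity
twist r t c = t c ⊕ t (c * r ^ 3 % 16)

parityLaw-prime^* : ∀ {p m t} → Prime p → IsOdd p → ¬ p ∣ m → ParityLaw m t →
  ∀ a → ParityLaw (p ^ suc a * m) (twist (p % 16) t)
parityLaw-prime^* {p} {m} {t} p-prime p-odd p∤m law a .at N (divides K N≡K*p^[1+a]*m) = begin
    parity (coprimeCount (p ^ suc a * m) (N / 8))  ≡⟨ cong parity (coprimeCount-^* p m a (N / 8)) ⟩
    parity (coprimeCount (p * m) (N / 8))          ≡⟨ parity-coprimeCount-prime* p-prime p∤m (N / 8) ⟩
    parity (coprimeCount m (N / 8)) ⊕ parity (coprimeCount m (N / 8 / p))
      ≡⟨ cong (λ y → parity (coprimeCount m (N / 8)) ⊕ parity (coprimeCount m y)) (m/n/o≡m/o/n N 8 p) ⟩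
    parity (coprimeCount m (N / 8)) ⊕ parity (coprimeCount m (N / p / 8))
      ≡⟨ cong₂ _⊕_ (law .at N m∣N) (law .at (N / p) m∣N/p) ⟩
    t (N % 16) ⊕ t (N / p % 16)                    ≡⟨ cong (λ c → t (N % 16) ⊕ t c) (≋⇒%≡ (/-≋-*^3 p-odd p∣N)) ⟩
    t (N % 16) ⊕ t (N % 16 * (p % 16) ^ 3 % 16)   ∎
  where
  open ≡-Reasoning
  instance
    p≢0 : NonZero p
    p≢0 = prime⇒nonZero p-prime
  N≡K*p^a*m*p : N ≡ K * (p ^ a * m) * p
  N≡K*p^a*m*p = trans N≡K*p^[1+a]*m
    (solve 4 (λ K p x m → K :* (p :* x :* m) := K :* (x :* m) :* p) refl K p (p ^ a) m)
  p∣N : p ∣ N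
  p∣N = divides (K * (p ^ a * m)) N≡K*p^a*m*p
  m∣N : m ∣ N
  m∣N = divides (K * p ^ suc a) (trans N≡K*p^[1+a]*m (sym (*-assoc K (p ^ suc a) m)))
  m∣N/p : m ∣ N / p
  m∣N/p = divides (K * p ^ a)
    (trans (trans (cong (_/ p) N≡K*p^a*m*p) (m*n/n≡m (K * (p ^ a * m)) p)) (sym (*-assoc K (p ^ a) m)))

Vanishes : (ℕ → Parity) → Set
Vanishes t = Below 16 (λ c → t c ≡ 0ℙ)

twist-vanishes : ∀ r {t} → Vanishes t → Vanishes (twist r t)
twist-vanishes r {t} t≡0 {c} c<16 = cong₂ _⊕_ (t≡0 c<16) (t≡0 (m%n<n (c * r ^ 3) 16))

threeTwists-vanish : OddResidues λ r₁ → OddResidues λ r₂ → OddResidues λ r₃ →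
  Vanishes (twist r₁ (twist r₂ (twist r₃ baseLaw)))
threeTwists-vanish = from-yes (oddResidues? λ r₁ → oddResidues? λ r₂ → oddResidues? λ r₃ →
  below? (λ c → twist r₁ (twist r₂ (twist r₃ baseLaw)) c ℙ.≟ 0ℙ) 16)

data LawShape (m : ℕ) : (ℕ → Parity) → Set where
  unit : m ≡ 1 → LawShape m baseLaw
  primePower : ∀ p a → OddPrime p → 1 ≤ a → m ≡ p ^ a → LawShape m (twist (p % 16) baseLaw)
  twoPrimePowers : ∀ p q a b → OddPrime p → OddPrime q → p ≢ q → 1 ≤ a → 1 ≤ b → m ≡ p ^ a * q ^ b →
    LawShape m (twist (p % 16) (twist (q % 16) baseLaw))
  vanishing : ∀ {t} → Vanishes t → LawShape m t

lawShape-prime^* : ∀ {p u t} → OddPrime p → ¬ p ∣ u → ∀ a → LawShape u t →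
  LawShape (p ^ suc a * u) (twist (p % 16) t)
lawShape-prime^* {p} p-oddPrime _ a (unit u≡1) =
  primePower p (suc a) p-oddPrime (s≤s z≤n) (trans (cong (p ^ suc a *_) u≡1) (*-identityʳ _))
lawShape-prime^* {p} p-oddPrime p∤u a (primePower q (suc b) q-oddPrime 1≤b u≡q^b) =
  twoPrimePowers p q (suc a) (suc b) p-oddPrime q-oddPrime p≢q (s≤s z≤n) 1≤b (cong (p ^ suc a *_) u≡q^b)
  where
  p≢q : p ≢ q
  p≢q refl = p∤u (subst (p ∣_) (sym u≡q^b) (m∣m*n (p ^ b)))
lawShape-prime^* {p} (_ , p-odd) _ a (twoPrimePowers q s _ _ (_ , q-odd) (_ , s-odd) _ _ _ _) =
  vanishing (threeTwists-vanish p p-odd q q-odd s s-odd)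
lawShape-prime^* {p} _ _ a (vanishing t≡0) = vanishing (twist-vanishes (p % 16) t≡0)

ClassifiedLaw : ℕ → Set
ClassifiedLaw m = Σ[ t ∈ (ℕ → Parity) ] (ParityLaw m t × LawShape m t)

classify : ∀ m → .{{NonZero m}} → IsOdd m → ClassifiedLaw m
classify = <-rec (λ m → .{{NonZero m}} → IsOdd m → ClassifiedLaw m) step
  where
  step : ∀ m → (∀ {k} → k < m → .{{NonZero k}} → IsOdd k → ClassifiedLaw k) →
    .{{NonZero m}} → IsOdd m → ClassifiedLaw m
  step m smaller m-odd with m ≟ 1
  ... | yes refl = baseLaw , parityLaw-1 , unit refl
  ... | no m≢1 with prime-divisor m m≢1
  ... | p , p-prime , p∣m with factorOut (prime≥2 p-prime) m
  ... | zero , u , m≡1*u , p∤u = ⊥-elim (p∤u (subst (p ∣_) (trans m≡1*u (*-identityˡ u)) p∣m))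
  ... | suc a , u , m≡p^[1+a]*u , p∤u = extend (smaller u<m {{u≢0}} (odd-∣ u∣m m-odd))
    where
    p-odd : IsOdd p
    p-odd = odd-∣ p∣m m-odd
    u∣m : u ∣ m
    u∣m = divides (p ^ suc a) m≡p^[1+a]*u
    u≢0 : NonZero u
    u≢0 = ≢-nonZero λ u≡0 →
      ≢-nonZero⁻¹ m (trans m≡p^[1+a]*u (trans (cong (p ^ suc a *_) u≡0) (*-zeroʳ (p ^ suc a))))
    u<m : u < m
    u<m = begin-strict
        u                 <⟨ m<m*n u p {{u≢0}} (prime≥2 p-prime) ⟩
        u * p             ≤⟨ *-monoʳ-≤ u (m≤m*n p (p ^ a) {{m^n≢0 p a {{prime⇒nonZero p-prime}}}}) ⟩
        u * p ^ suc a     ≡⟨ *-comm u (p ^ suc a) ⟩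
        p ^ suc a * u     ≡⟨ m≡p^[1+a]*u ⟨
        m                 ∎
      where open ≤-Reasoning
    extend : ClassifiedLaw u → ClassifiedLaw m
    extend (t , law , shape) = twist (p % 16) t
      , subst (λ n → ParityLaw n (twist (p % 16) t)) (sym m≡p^[1+a]*u) (parityLaw-prime^* p-prime p-odd p∤u law a)
      , subst (λ n → LawShape n (twist (p % 16) t)) (sym m≡p^[1+a]*u) (lawShape-prime^* (p-prime , p-odd) p∤u a shape)

-- The power of two

dyadicParity : ℕ → ℕ → (ℕ → Parity) → Parity
dyadicParity zero u t = t u
dyadicParity (suc k) u t = t (2 ^ suc k * u % 16) ⊕ t (2 ^ k * u % 16)

parity-φ8-2^k* : ∀ k {m t} → IsOdd m → ParityLaw m t → parity (φ 8 (2 ^ k * m)) ≡ dyadicParity k (m % 16) t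
parity-φ8-2^k* zero {m} {t} m-odd law = begin
    parity (coprimeCount (1 * m) (1 * m / 8)) ≡⟨ cong (λ z → parity (coprimeCount z (z / 8))) (*-identityˡ m) ⟩
    parity (coprimeCount m (m / 8))           ≡⟨ law .at m ∣-refl ⟩
    t (m % 16)                                ∎
  where open ≡-Reasoning
parity-φ8-2^k* (suc k) {m} {t} m-odd law = begin
    parity (coprimeCount n (n / 8))        ≡⟨ cong parity (coprimeCount-^* 2 m k (n / 8)) ⟩
    parity (coprimeCount (2 * m) (n / 8))  ≡⟨ parity-coprimeCount-prime* prime[2] (odd⇒2∤ m-odd) (n / 8) ⟩
    parity (coprimeCount m (n / 8)) ⊕ parity (coprimeCount m (n / 8 / 2))
      ≡⟨ cong (λ y → parity (coprimeCount m (n / 8)) ⊕ parity (coprimeCount m y))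
              (trans (m/n/o≡m/o/n n 8 2) (cong (_/ 8) n/2≡h)) ⟩
    parity (coprimeCount m (n / 8)) ⊕ parity (coprimeCount m (h / 8))
      ≡⟨ cong₂ _⊕_ (law .at n (divides (2 ^ suc k) refl)) (law .at h (divides (2 ^ k) refl)) ⟩
    t (n % 16) ⊕ t (h % 16)                ≡⟨ cong₂ (λ a b → t a ⊕ t b) (reduce (suc k)) (reduce k) ⟩
    dyadicParity (suc k) (m % 16) t        ∎
  where
  open ≡-Reasoning
  n = 2 ^ suc k * m
  h = 2 ^ k * m
  n/2≡h : n / 2 ≡ h
  n/2≡h = trans (cong (_/ 2) (trans (*-assoc 2 (2 ^ k) m) (*-comm 2 h))) (m*n/n≡m h 2)
  reduce : ∀ j → 2 ^ j * m % 16 ≡ 2 ^ j * (m % 16) % 16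
  reduce j = ≋⇒%≡ (*-cong-≋ (≋-refl (2 ^ j)) (≋-sym (%-≋ m)))

dyadicParity-5+ : ∀ k u t → dyadicParity (5 + k) u t ≡ 0ℙ
dyadicParity-5+ k u t = begin
    t (2 ^ (5 + k) * u % 16) ⊕ t (2 ^ (4 + k) * u % 16) ≡⟨ cong₂ (λ a b → t a ⊕ t b) (16∣ (1 + k)) (16∣ k) ⟩
    t 0 ⊕ t 0                                          ≡⟨ ℙ.p+p≡0ℙ (t 0) ⟩
    0ℙ                                                 ∎
  where
  open ≡-Reasoning
  16∣ : ∀ j → 2 ^ (4 + j) * u % 16 ≡ 0
  16∣ j = trans (cong (_% 16) regroup) (m*n%n≡0 (2 ^ j * u) 16)
    where
    regroup : 2 ^ (4 + j) * u ≡ 2 ^ j * u * 16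
    regroup = trans (cong (_* u) (^-distribˡ-+-* 2 4 j)) (trans (*-assoc 16 (2 ^ j) u) (*-comm 16 (2 ^ j * u)))

dyadicParity≡1ℙ⇒<5 : ∀ k {u t} → dyadicParity k u t ≡ 1ℙ → k < 5
dyadicParity≡1ℙ⇒<5 k {u} {t} d≡1 with k <? 5
... | yes k<5 = k<5
... | no k≮5 = ⊥-elim (ℙ.p≢p⁻¹ 0ℙ (begin
    0ℙ                             ≡⟨ dyadicParity-5+ (k ∸ 5) u t ⟨
    dyadicParity (5 + (k ∸ 5)) u t ≡⟨ cong (λ j → dyadicParity j u t) (m+[n∸m]≡n (≮⇒≥ k≮5)) ⟩
    dyadicParity k u t             ≡⟨ d≡1 ⟩
    1ℙ                             ∎))
  where open ≡-Reasoning

dyadicParity-vanishing : ∀ k u {t} → u < 16 → Vanishes t → dyadicParity k u t ≡ 0ℙ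
dyadicParity-vanishing zero u u<16 t≡0 = t≡0 u<16
dyadicParity-vanishing (suc k) u u<16 t≡0 = cong₂ _⊕_ (t≡0 (m%n<n (2 ^ suc k * u) 16)) (t≡0 (m%n<n (2 ^ k * u) 16))

T-≡ᵇ : ∀ {m n} → T (m ≡ᵇ n) ⇔ m ≡ n
T-≡ᵇ = mk⇔ (≡ᵇ⇒≡ _ _) (≡⇒≡ᵇ _ _)

T-∨-⇔ : ∀ {x y} {A B : Set} → T x ⇔ A → T y ⇔ B → T (x ∨ y) ⇔ (A ⊎ B)
T-∨-⇔ x⇔A y⇔B = ⇔-trans T-∨ (x⇔A ⊎-⇔ y⇔B)

T-∧-⇔ : ∀ {x y} {A B : Set} → T x ⇔ A → T y ⇔ B → T (x ∧ y) ⇔ (A × B)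
T-∧-⇔ x⇔A y⇔B = ⇔-trans T-∧ (x⇔A ×-⇔ y⇔B)

cond1ᵇ cond2ᵇ : ℕ → ℕ → Bool
cond1ᵇ r o = ((r ≡ᵇ 9) ∨ (r ≡ᵇ 15))
           ∨ ((((r ≡ᵇ 3) ∨ (r ≡ᵇ 5)) ∧ (o ≡ᵇ 0)) ∨ (((r ≡ᵇ 11) ∨ (r ≡ᵇ 13)) ∧ (o ≡ᵇ 1)))
cond2ᵇ r o = ((r ≡ᵇ 7) ∨ (r ≡ᵇ 9))
           ∨ ((((r ≡ᵇ 3) ∨ (r ≡ᵇ 13)) ∧ (o ≡ᵇ 0)) ∨ (((r ≡ᵇ 5) ∨ (r ≡ᵇ 11)) ∧ (o ≡ᵇ 1)))

cond3ᵇ cond4ᵇ : ℕ → Bool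
cond3ᵇ s = (s ≡ᵇ 3) ∨ (s ≡ᵇ 5)
cond4ᵇ s = (s ≡ᵇ 3) ∨ (s ≡ᵇ 7)

condPairᵇ : ℕ → ℕ → Bool
condPairᵇ s₁ s₂ = ((s₁ ≡ᵇ 3) ∧ (s₂ ≡ᵇ 3))
                ∨ (((s₁ ≡ᵇ 5) ∧ (s₂ ≡ᵇ 5)) ∨ ((s₁ ≡ᵇ 3) ∧ (s₂ ≡ᵇ 5)))

cond1-reflects : ∀ p α → T (cond1ᵇ (p % 16) (α % 2)) ⇔ cond1 p α
cond1-reflects p α = T-∨-⇔ (T-∨-⇔ T-≡ᵇ T-≡ᵇ)
  (T-∨-⇔ (T-∧-⇔ (T-∨-⇔ T-≡ᵇ T-≡ᵇ) T-≡ᵇ) (T-∧-⇔ (T-∨-⇔ T-≡ᵇ T-≡ᵇ) T-≡ᵇ))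

cond2-reflects : ∀ p α → T (cond2ᵇ (p % 16) (α % 2)) ⇔ cond2 p α
cond2-reflects p α = T-∨-⇔ (T-∨-⇔ T-≡ᵇ T-≡ᵇ)
  (T-∨-⇔ (T-∧-⇔ (T-∨-⇔ T-≡ᵇ T-≡ᵇ) T-≡ᵇ) (T-∧-⇔ (T-∨-⇔ T-≡ᵇ T-≡ᵇ) T-≡ᵇ))

T-%16%8≡ᵇ : ∀ p {n} → T (p % 16 % 8 ≡ᵇ n) ⇔ p % 8 ≡ n
T-%16%8≡ᵇ p = ⇔-trans T-≡ᵇ (mk⇔ (trans (sym (%16%8≡%8 p))) (trans (%16%8≡%8 p)))

cond3-reflects : ∀ p → T (cond3ᵇ (p % 16 % 8)) ⇔ cond3 p
cond3-reflects p = T-∨-⇔ (T-%16%8≡ᵇ p) (T-%16%8≡ᵇ p)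

cond4-reflects : ∀ p → T (cond4ᵇ (p % 16 % 8)) ⇔ cond4 p
cond4-reflects p = T-∨-⇔ (T-%16%8≡ᵇ p) (T-%16%8≡ᵇ p)

condPair-reflects : ∀ p₁ p₂ → T (condPairᵇ (p₁ % 16 % 8) (p₂ % 16 % 8)) ⇔ condPair p₁ p₂
condPair-reflects p₁ p₂ = T-∨-⇔ (T-∧-⇔ (T-%16%8≡ᵇ p₁) (T-%16%8≡ᵇ p₂))
  (T-∨-⇔ (T-∧-⇔ (T-%16%8≡ᵇ p₁) (T-%16%8≡ᵇ p₂)) (T-∧-⇔ (T-%16%8≡ᵇ p₁) (T-%16%8≡ᵇ p₂)))

condPair-either-reflects : ∀ p q →
  T (condPairᵇ (p % 16 % 8) (q % 16 % 8) ∨ condPairᵇ (q % 16 % 8) (p % 16 % 8)) ⇔ (condPair p q ⊎ condPair q p)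
condPair-either-reflects p q = T-∨-⇔ (condPair-reflects p q) (condPair-reflects q p)

oddIf : Bool → Parity
oddIf b = if b then 1ℙ else 0ℙ

oddIf≡1ℙ⇒T : ∀ {b} → oddIf b ≡ 1ℙ → T b
oddIf≡1ℙ⇒T {true} _ = _

T⇒oddIf≡1ℙ : ∀ {b} → T b → oddIf b ≡ 1ℙ
T⇒oddIf≡1ℙ {true} _ = refl

≡oddIf⇒T : ∀ {x b} → x ≡ oddIf b → x ≡ 1ℙ → T b
≡oddIf⇒T x≡oddIf x≡1 = oddIf≡1ℙ⇒T (trans (sym x≡oddIf) x≡1)

expectedPowerOfTwo : ℕ → Bool
expectedPowerOfTwo k = (k ≡ᵇ 3) ∨ (k ≡ᵇ 4)

-- The condition of form (k + 1) of the theorem on n = 2^k p^α, in terms of r = p mod 16 and o = α mod 2.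
expectedPrimePower : ℕ → ℕ → ℕ → Bool
expectedPrimePower 0 r o = cond1ᵇ r o
expectedPrimePower 1 r o = cond2ᵇ r o
expectedPrimePower 2 r _ = cond3ᵇ (r % 8)
expectedPrimePower 3 r _ = cond4ᵇ (r % 8)
expectedPrimePower _ _ _ = false

expectedTwoPrimePowers : ℕ → ℕ → ℕ → Bool
expectedTwoPrimePowers k r₁ r₂ = (k ≤ᵇ 1) ∧ (condPairᵇ (r₁ % 8) (r₂ % 8) ∨ condPairᵇ (r₂ % 8) (r₁ % 8))

powersOfTwo-table : Below 5 λ k → dyadicParity k 1 baseLaw ≡ oddIf (expectedPowerOfTwo k)
powersOfTwo-table = from-yes (below? (λ k → dyadicParity k 1 baseLaw ℙ.≟ oddIf (expectedPowerOfTwo k)) 5)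

primePower-table : Below 5 λ k → OddResidues λ r → Below 4 λ e →
  dyadicParity k (r ^ e % 16) (twist r baseLaw) ≡ oddIf (expectedPrimePower k r (e % 2))
primePower-table = from-yes (below? (λ k → oddResidues? λ r → below? (λ e →
  dyadicParity k (r ^ e % 16) (twist r baseLaw) ℙ.≟ oddIf (expectedPrimePower k r (e % 2))) 4) 5)

twoPrimePowers-table : Below 5 λ k → OddResidues λ r₁ → Below 4 λ e₁ → OddResidues λ r₂ → Below 4 λ e₂ →
  dyadicParity k (r₁ ^ e₁ * r₂ ^ e₂ % 16) (twist r₁ (twist r₂ baseLaw)) ≡ oddIf (expectedTwoPrimePowers k r₁ r₂)
twoPrimePowers-table = from-yes
  (below? (λ k → oddResidues? λ r₁ → below? (λ e₁ → oddResidues? λ r₂ → below? (λ e₂ →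
    dyadicParity k (r₁ ^ e₁ * r₂ ^ e₂ % 16) (twist r₁ (twist r₂ baseLaw))
      ℙ.≟ oddIf (expectedTwoPrimePowers k r₁ r₂)) 4) 4) 5)

parity-φ8-2^k*1 : ∀ {k} → k < 5 → parity (φ 8 (2 ^ k * 1)) ≡ oddIf (expectedPowerOfTwo k)
parity-φ8-2^k*1 {k} k<5 = trans (parity-φ8-2^k* k refl parityLaw-1) (powersOfTwo-table k<5)

parity-φ8-2^k*p^a : ∀ {k p} → k < 5 → OddPrime p → ∀ a → 1 ≤ a →
  parity (φ 8 (2 ^ k * p ^ a)) ≡ oddIf (expectedPrimePower k (p % 16) (a % 2))
parity-φ8-2^k*p^a {k} {p} k<5 (p-prime , p-odd) a@(suc a-1) _ = begin
    parity (φ 8 (2 ^ k * p ^ a))      ≡⟨ cong (λ m → parity (φ 8 (2 ^ k * m))) (*-identityʳ (p ^ a)) ⟨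
    parity (φ 8 (2 ^ k * (p ^ a * 1))) ≡⟨ parity-φ8-2^k* k (odd-* (p ^ a) 1 (odd-^ p p-odd a) refl) law ⟩
    dyadicParity k (p ^ a * 1 % 16) (twist r baseLaw)
      ≡⟨ cong (λ u → dyadicParity k u (twist r baseLaw))
              (≋⇒%≡ (≋-trans (≡⇒≋ (*-identityʳ (p ^ a))) (odd⇒^≋^%4 p p-odd a))) ⟩
    dyadicParity k (r ^ (a % 4) % 16) (twist r baseLaw)  ≡⟨ primePower-table k<5 p p-odd (m%n<n a 4) ⟩
    oddIf (expectedPrimePower k r (a % 4 % 2))           ≡⟨ cong (oddIf ∘ expectedPrimePower k r) (%4%2≡%2 a) ⟩
    oddIf (expectedPrimePower k r (a % 2))               ∎
  where
  open ≡-Reasoning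
  r = p % 16
  law : ParityLaw (p ^ a * 1) (twist r baseLaw)
  law = parityLaw-prime^* p-prime p-odd (prime∤1 p-prime) parityLaw-1 a-1

parity-φ8-2^k*p^a*q^b : ∀ {k p q} → k < 5 → OddPrime p → OddPrime q → p ≢ q → ∀ a b → 1 ≤ a → 1 ≤ b →
  parity (φ 8 (2 ^ k * (p ^ a * q ^ b))) ≡ oddIf (expectedTwoPrimePowers k (p % 16) (q % 16))
parity-φ8-2^k*p^a*q^b {k} {p} {q} k<5 (p-prime , p-odd) (q-prime , q-odd) p≢q a@(suc a-1) b@(suc b-1) _ _ = begin
    parity (φ 8 (2 ^ k * (p ^ a * q ^ b)))
      ≡⟨ cong (λ m → parity (φ 8 (2 ^ k * (p ^ a * m)))) (*-identityʳ (q ^ b)) ⟨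
    parity (φ 8 (2 ^ k * (p ^ a * (q ^ b * 1))))  ≡⟨ parity-φ8-2^k* k m-odd law ⟩
    dyadicParity k (m % 16) (twist r₁ (twist r₂ baseLaw))
      ≡⟨ cong (λ u → dyadicParity k u (twist r₁ (twist r₂ baseLaw))) (≋⇒%≡ m≋) ⟩
    dyadicParity k (r₁ ^ (a % 4) * r₂ ^ (b % 4) % 16) (twist r₁ (twist r₂ baseLaw))
      ≡⟨ twoPrimePowers-table k<5 p p-odd (m%n<n a 4) q q-odd (m%n<n b 4) ⟩
    oddIf (expectedTwoPrimePowers k r₁ r₂) ∎
  where
  open ≡-Reasoning
  r₁ = p % 16
  r₂ = q % 16
  m = p ^ a * (q ^ b * 1)
  m-odd : IsOdd m
  m-odd = odd-* (p ^ a) (q ^ b * 1) (odd-^ p p-odd a) (odd-* (q ^ b) 1 (odd-^ q q-odd b) refl)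
  m≋ : m ≋ r₁ ^ (a % 4) * r₂ ^ (b % 4)
  m≋ = *-cong-≋ (odd⇒^≋^%4 p p-odd a) (≋-trans (≡⇒≋ (*-identityʳ (q ^ b))) (odd⇒^≋^%4 q q-odd b))
  p∤q^b : ¬ p ∣ q ^ b * 1
  p∤q^b p∣q^b = p≢q (prime∣^⇒≡ p-prime q-prime b (subst (p ∣_) (*-identityʳ (q ^ b)) p∣q^b))
  law : ParityLaw m (twist r₁ (twist r₂ baseLaw))
  law = parityLaw-prime^* p-prime p-odd p∤q^b (parityLaw-prime^* q-prime q-odd (prime∤1 q-prime) parityLaw-1 b-1) a-1

exceptional-2^k*1 : ∀ k → T (expectedPowerOfTwo k) → Exceptional (2 ^ k * 1)
exceptional-2^k*1 3 _ = inj₁ refl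
exceptional-2^k*1 4 _ = inj₂ (inj₁ refl)
exceptional-2^k*1 (suc (suc (suc (suc (suc _))))) ()

exceptional-2^k*p^a : ∀ k {p a} → OddPrime p → 1 ≤ a → T (expectedPrimePower k (p % 16) (a % 2)) →
  Exceptional (2 ^ k * p ^ a)
exceptional-2^k*p^a 0 {p} {a} p-oddPrime 1≤a c =
  inj₂ (inj₂ (inj₁ (p , a , p-oddPrime , 1≤a , *-identityˡ (p ^ a) , cond1-reflects p a .Equivalence.to c)))
exceptional-2^k*p^a 1 {p} {a} p-oddPrime 1≤a c =
  inj₂ (inj₂ (inj₂ (inj₁ (p , a , p-oddPrime , 1≤a , refl , cond2-reflects p a .Equivalence.to c))))
exceptional-2^k*p^a 2 {p} {a} p-oddPrime 1≤a c =
  inj₂ (inj₂ (inj₂ (inj₂ (inj₁ (p , a , p-oddPrime , 1≤a , refl , cond3-reflects p .Equivalence.to c)))))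
exceptional-2^k*p^a 3 {p} {a} p-oddPrime 1≤a c =
  inj₂ (inj₂ (inj₂ (inj₂ (inj₂ (inj₁ (p , a , p-oddPrime , 1≤a , refl , cond4-reflects p .Equivalence.to c))))))
exceptional-2^k*p^a (suc (suc (suc (suc _)))) _ _ ()

exceptional-2^k*p^a*q^b : ∀ k {p q a b} → OddPrime p → OddPrime q → p ≢ q → 1 ≤ a → 1 ≤ b →
  T (expectedTwoPrimePowers k (p % 16) (q % 16)) → Exceptional (2 ^ k * (p ^ a * q ^ b))
exceptional-2^k*p^a*q^b 0 {p} {q} {a} {b} p-op q-op p≢q 1≤a 1≤b c with condPair-either-reflects p q .Equivalence.to c
... | inj₁ pq = inj₂ (inj₂ (inj₂ (inj₂ (inj₂ (inj₂ (inj₁ (p , q , a , b , p-op , q-op , p≢q , 1≤a , 1≤b ,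
  *-identityˡ _ , pq)))))))
... | inj₂ qp = inj₂ (inj₂ (inj₂ (inj₂ (inj₂ (inj₂ (inj₁ (q , p , b , a , q-op , p-op , ≢-sym p≢q , 1≤b , 1≤a ,
  trans (*-identityˡ _) (*-comm (p ^ a) (q ^ b)) , qp)))))))
exceptional-2^k*p^a*q^b 1 {p} {q} {a} {b} p-op q-op p≢q 1≤a 1≤b c with condPair-either-reflects p q .Equivalence.to c
... | inj₁ pq = inj₂ (inj₂ (inj₂ (inj₂ (inj₂ (inj₂ (inj₂ (p , q , a , b , p-op , q-op , p≢q , 1≤a , 1≤b ,
  refl , pq)))))))
... | inj₂ qp = inj₂ (inj₂ (inj₂ (inj₂ (inj₂ (inj₂ (inj₂ (q , p , b , a , q-op , p-op , ≢-sym p≢q , 1≤b , 1≤a ,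
  cong (2 *_) (*-comm (p ^ a) (q ^ b)) , qp)))))))
exceptional-2^k*p^a*q^b (suc (suc _)) _ _ _ _ _ ()

parity-φ8≡1ℙ⇒k<5 : ∀ k {m t} → IsOdd m → ParityLaw m t → parity (φ 8 (2 ^ k * m)) ≡ 1ℙ → k < 5
parity-φ8≡1ℙ⇒k<5 k m-odd law φ≡1 = dyadicParity≡1ℙ⇒<5 k (trans (sym (parity-φ8-2^k* k m-odd law)) φ≡1)

exceptional-2^k* : ∀ k {m t} → IsOdd m → ParityLaw m t → LawShape m t →
  parity (φ 8 (2 ^ k * m)) ≡ 1ℙ → Exceptional (2 ^ k * m)
exceptional-2^k* k m-odd law (unit refl) φ≡1 =
  exceptional-2^k*1 k (≡oddIf⇒T (parity-φ8-2^k*1 (parity-φ8≡1ℙ⇒k<5 k m-odd law φ≡1)) φ≡1)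
exceptional-2^k* k m-odd law (primePower p a p-op 1≤a refl) φ≡1 =
  exceptional-2^k*p^a k p-op 1≤a
    (≡oddIf⇒T (parity-φ8-2^k*p^a (parity-φ8≡1ℙ⇒k<5 k m-odd law φ≡1) p-op a 1≤a) φ≡1)
exceptional-2^k* k m-odd law (twoPrimePowers p q a b p-op q-op p≢q 1≤a 1≤b refl) φ≡1 =
  exceptional-2^k*p^a*q^b k p-op q-op p≢q 1≤a 1≤b
    (≡oddIf⇒T (parity-φ8-2^k*p^a*q^b (parity-φ8≡1ℙ⇒k<5 k m-odd law φ≡1) p-op q-op p≢q a b 1≤a 1≤b) φ≡1)
exceptional-2^k* k {m} {t} m-odd law (vanishing t≡0) φ≡1 = ⊥-elim (ℙ.p≢p⁻¹ 0ℙ (begin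
    0ℙ                                ≡⟨ dyadicParity-vanishing k (m % 16) (m%n<n m 16) t≡0 ⟨
    dyadicParity k (m % 16) t         ≡⟨ parity-φ8-2^k* k m-odd law ⟨
    parity (φ 8 (2 ^ k * m))          ≡⟨ φ≡1 ⟩
    1ℙ                                ∎))
  where open ≡-Reasoning

φ8-odd⇒exceptional : ∀ n → 1 ≤ n → IsOdd (φ 8 n) → Exceptional n
φ8-odd⇒exceptional n 1≤n φ-odd with factorOut (≤-refl {2}) n {{>-nonZero 1≤n}}
... | k , m , n≡2^k*m , 2∤m with classify m {{m≢0}} (2∤⇒odd 2∤m)
  where
  m≢0 : NonZero m
  m≢0 = ≢-nonZero λ m≡0 → 2∤m (subst (2 ∣_) (sym m≡0) (2 ∣0))
... | t , law , shape = subst Exceptional (sym n≡2^k*m)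
  (exceptional-2^k* k (2∤⇒odd 2∤m) law shape
    (subst (λ x → parity (φ 8 x) ≡ 1ℙ) n≡2^k*m (odd⇒parity≡1ℙ {φ 8 n} φ-odd)))

odd-φ8 : ∀ n {b} → parity (φ 8 n) ≡ oddIf b → T b → IsOdd (φ 8 n)
odd-φ8 n φ≡oddIf b = parity≡1ℙ⇒odd {φ 8 n} (trans φ≡oddIf (T⇒oddIf≡1ℙ b))

exceptional⇒φ8-odd : ∀ n → Exceptional n → IsOdd (φ 8 n)
exceptional⇒φ8-odd n (inj₁ refl) = odd-φ8 n (parity-φ8-2^k*1 {3} (s≤s (s≤s (s≤s (s≤s z≤n))))) _
exceptional⇒φ8-odd n (inj₂ (inj₁ refl)) = odd-φ8 n (parity-φ8-2^k*1 {4} ≤-refl) _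
exceptional⇒φ8-odd n (inj₂ (inj₂ (inj₁ (p , a , p-op , 1≤a , refl , c)))) =
  odd-φ8 n (trans (cong (λ x → parity (φ 8 x)) (sym (*-identityˡ (p ^ a))))
                  (parity-φ8-2^k*p^a {0} (s≤s z≤n) p-op a 1≤a))
    (cond1-reflects p a .Equivalence.from c)
exceptional⇒φ8-odd n (inj₂ (inj₂ (inj₂ (inj₁ (p , a , p-op , 1≤a , refl , c))))) =
  odd-φ8 n (parity-φ8-2^k*p^a {1} (s≤s (s≤s z≤n)) p-op a 1≤a) (cond2-reflects p a .Equivalence.from c)
exceptional⇒φ8-odd n (inj₂ (inj₂ (inj₂ (inj₂ (inj₁ (p , a , p-op , 1≤a , refl , c)))))) =
  odd-φ8 n (parity-φ8-2^k*p^a {2} (s≤s (s≤s (s≤s z≤n))) p-op a 1≤a)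
    (cond3-reflects p .Equivalence.from c)
exceptional⇒φ8-odd n (inj₂ (inj₂ (inj₂ (inj₂ (inj₂ (inj₁ (p , a , p-op , 1≤a , refl , c))))))) =
  odd-φ8 n (parity-φ8-2^k*p^a {3} (s≤s (s≤s (s≤s (s≤s z≤n)))) p-op a 1≤a)
    (cond4-reflects p .Equivalence.from c)
exceptional⇒φ8-odd n (inj₂ (inj₂ (inj₂ (inj₂ (inj₂ (inj₂ (inj₁ (p , q , a , b , p-op , q-op , p≢q , 1≤a , 1≤b , refl , c)))))))) =
  odd-φ8 n (trans (cong (λ x → parity (φ 8 x)) (sym (*-identityˡ (p ^ a * q ^ b))))
    (parity-φ8-2^k*p^a*q^b {0} (s≤s z≤n) p-op q-op p≢q a b 1≤a 1≤b))
    (condPair-either-reflects p q .Equivalence.from (inj₁ c))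
exceptional⇒φ8-odd n (inj₂ (inj₂ (inj₂ (inj₂ (inj₂ (inj₂ (inj₂ (p , q , a , b , p-op , q-op , p≢q , 1≤a , 1≤b , refl , c)))))))) =
  odd-φ8 n (parity-φ8-2^k*p^a*q^b {1} (s≤s (s≤s z≤n)) p-op q-op p≢q a b 1≤a 1≤b)
    (condPair-either-reflects p q .Equivalence.from (inj₁ c))

theorem5p1 : (n : ℕ) → 1 ≤ n → (IsOdd (φ 8 n) → Exceptional n) × (Exceptional n → IsOdd (φ 8 n))
theorem5p1 n 1≤n = φ8-odd⇒exceptional n 1≤n , exceptional⇒φ8-odd n
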